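{- Let $G$ be a finite group and let $\mathcal{G}(G)$ denote its power graph. Then $\kappa'(\mathcal{G}(G))=\delta(\mathcal{G}(G))$.
   Context: The power graph $\mathcal{G}(G)$ of a group $G$ is the simple undirected graph with vertex set $G$ in which distinct $u,v$ are adjacent iff $v=u^{\alpha}$ for some $\alpha\in\mathbb{N}$ or $u=v^{\beta}$ for some $\beta\in\mathbb{N}$. For a graph $\Gamma$, $\delta(\Gamma)$ is its minimum degree and $\kappa'(\Gamma)$ its edge-connectivity: the minimum number of edges whose removal results in a disconnected or trivial (one-vertex) graph (so it is $0$ for disconnected or trivial graphs). -}

module Defs where

open import Data.Nat using (ℕ; zero; suc; _≤_)
open import Data.Fin using (Fin)
open import Data.Fin.Subset using (Subset; _∈_; ∣_∣)
open import Data.List using (List; length)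
open import Data.List.Membership.Propositional using () renaming (_∈_ to _∈ˡ_)
open import Data.List.Relation.Unary.All using (All)
open import Data.List.Relation.Unary.AllPairs using (AllPairs)
open import Data.Product using (Σ; ∃; ∃₂; _×_; _,_; proj₁; proj₂; swap)
open import Data.Sum using (_⊎_)
open import Relation.Nullary using (¬_)
open import Relation.Binary.PropositionalEquality using (_≡_; _≢_)
open import Relation.Binary.Construct.Closure.ReflexiveTransitive using (Star)
open import Algebra.Core using (Op₁; Op₂)
open import Algebra.Structures using (IsGroup)

-- Finite groups: a group whose carrier is Fin n (every finite group is
-- isomorphic to one of this form), with propositional equality.

record FiniteGroup : Set₁ where
  field
    n       : ℕ
    _∙_     : Op₂ (Fin n)
    ε       : Fin n
    _⁻¹     : Op₁ (Fin n)
    isGroup : IsGroup _≡_ _∙_ ε _⁻¹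

  pow : Fin n → ℕ → Fin n
  pow u zero    = ε
  pow u (suc k) = u ∙ pow u k

PowerAdj : (G : FiniteGroup) → Fin (FiniteGroup.n G) → Fin (FiniteGroup.n G) → Set
PowerAdj G u v =
  u ≢ v × ((∃ λ α → v ≡ pow u (suc α)) ⊎ (∃ λ β → u ≡ pow v (suc β)))
  where open FiniteGroup G

module _ {n : ℕ} (Adj : Fin n → Fin n → Set) where

  IsNeighbourhood : Fin n → Subset n → Set
  IsNeighbourhood v S = ∀ u → (u ∈ S → Adj v u) × (Adj v u → u ∈ S)

  IsMinDegree : ℕ → Set
  IsMinDegree d =
    (∃₂ λ v S → IsNeighbourhood v S × ∣ S ∣ ≡ d)
    × (∀ v S → IsNeighbourhood v S → d ≤ ∣ S ∣)

  IsEdgeSet : List (Fin n × Fin n) → Set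
  IsEdgeSet F =
    All (λ e → Adj (proj₁ e) (proj₂ e)) F
    × AllPairs (λ e f → e ≢ f × e ≢ swap f) F

  DeleteEdges : List (Fin n × Fin n) → Fin n → Fin n → Set
  DeleteEdges F u v = Adj u v × ¬ ((u , v) ∈ˡ F ⊎ (v , u) ∈ˡ F)

DisconnectedOrTrivial : (n : ℕ) → (Fin n → Fin n → Set) → Set
DisconnectedOrTrivial n R = n ≤ 1 ⊎ (∃₂ λ u v → ¬ Star R u v)

IsEdgeConnectivity : {n : ℕ} → (Fin n → Fin n → Set) → ℕ → Set
IsEdgeConnectivity {n} Adj k =
  (∃ λ F → IsEdgeSet Adj F × length F ≡ k
           × DisconnectedOrTrivial n (DeleteEdges Adj F))
  × (∀ F → IsEdgeSet Adj F → DisconnectedOrTrivial n (DeleteEdges Adj F)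
         → k ≤ length F)

module Submission where

-- The group theory enters only through one fact: every non-identity
-- element y has finite order, so ε = y ^ (ord y) and the identity is a
-- dominating vertex of the power graph.  The theorem is then an instance
-- of a purely graph-theoretic statement: in a finite graph with a
-- dominating vertex (a "hub"), κ' = δ.
--
-- Upper bound: deleting the edges at a vertex v₀ of minimum degree
-- isolates v₀.  Lower bound: let F be an edge set whose deletion
-- disconnects u from v.  Say x is "blocked" if, for every neighbour y of
-- x, one of the edges xy, y–hub lies in F.  If neither u nor v were blocked,
-- both would still reach the hub along a route x–y–hub, hence each other; so
-- some x is blocked.  Sending each neighbour y of x to an edge of F that
-- blocks the route x–y–hub is injective, whence δ ≤ deg x ≤ |F|.

open import Defs
open import Data.Nat using (ℕ; zero; suc; _+_; _≤_; _<_; z≤n; s≤s; s≤s⁻¹; _≤?_)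
open import Data.Nat.Properties as ℕ using (module ≤-Reasoning)
open import Data.Fin as Fin using (Fin; toℕ; fromℕ<; punchIn)
import Data.Fin.Properties as Fin
open import Data.Fin.Subset using (Subset; inside; outside; ∣_∣) renaming (_∈_ to _∈ₛ_)
open import Data.Fin.Subset.Properties using (⊆-antisym)
open import Data.Vec using ([]; _∷_; here; there; tabulate)
import Data.Vec.Properties as Vec
open import Data.Bool using (true)
open import Data.List using (List; []; _∷_; _++_; length; map; allFin)
open import Data.List.Properties using (length-map; length-++-sucʳ)
open import Data.List.Membership.Propositional using (_∈_; find; lose)
open import Data.List.Membership.Propositional.Properties using (∈-map⁺; ∈-map⁻; ∈-∃++; ∈-allFin)
open import Data.List.Relation.Unary.Any as Any using (Any; here; there; any?)
import Data.List.Relation.Unary.Any.Properties as Anyₚ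
open import Data.List.Relation.Unary.All as All using (All; []; _∷_)
import Data.List.Relation.Unary.All.Properties as All
open import Data.List.Relation.Unary.AllPairs using (AllPairs; []; _∷_)
open import Data.List.Relation.Unary.Unique.Propositional using (Unique)
import Data.List.Relation.Unary.Unique.Propositional.Properties as Unique
open import Data.List.Extrema.Nat using (argmin; f[argmin]≤f[xs])
open import Data.Product using (Σ; ∃; _×_; _,_; proj₁; proj₂; swap)
open import Data.Sum using (_⊎_; inj₁; inj₂; [_,_]) renaming (swap to ⊎-swap)
open import Data.Empty using (⊥-elim)
open import Function using (_∘_)
open import Relation.Nullary using (¬_; Dec; yes; no; does)
open import Relation.Nullary.Decidable using (_×-dec_; _⊎-dec_; ¬?; _→-dec_; map′; dec-true)
open import Relation.Binary.PropositionalEquality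
  using (_≡_; _≢_; refl; sym; trans; cong; subst; module ≡-Reasoning)
open import Relation.Binary.Construct.Closure.ReflexiveTransitive as RT using (Star; _◅_; _◅◅_)
open import Algebra.Bundles using (Group)
import Algebra.Properties.Group as GroupProperties
open import Algebra.Structures using (IsGroup)

witnessed-length-≤ : {A B : Set} (R : A → B → Set) →
  (∀ {x x′ e} → R x e → R x′ e → x ≡ x′) →
  ∀ {xs ys} → Unique xs → All (λ x → Any (R x) ys) xs → length xs ≤ length ys
witnessed-length-≤ R R-inj [] [] = z≤n
witnessed-length-≤ R R-inj {x ∷ xs} (x∉xs ∷ uniq) (wx ∷ ws)
  with e , e∈ys , Rxe ← find wx
  with us , vs , refl ← ∈-∃++ e∈ys = begin
    suc (length xs)          ≤⟨ s≤s (witnessed-length-≤ R R-inj uniq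
                                       (All.zipWith (λ (x≢z , wz) → without-e x≢z wz) (x∉xs , ws))) ⟩
    suc (length (us ++ vs))  ≡⟨ length-++-sucʳ us e vs ⟨
    length (us ++ e ∷ vs)    ∎
  where
  open ≤-Reasoning
  -- e is the witness of x, so it cannot be the witness of any other z
  without-e : ∀ {z} → x ≢ z → Any (R z) (us ++ e ∷ vs) → Any (R z) (us ++ vs)
  without-e x≢z w with Anyₚ.++⁻ us w
  ... | inj₁ w′           = Anyₚ.++⁺ˡ w′
  ... | inj₂ (here Rze)   = ⊥-elim (x≢z (R-inj Rxe Rze))
  ... | inj₂ (there w′)   = Anyₚ.++⁺ʳ us w′

toList : ∀ {n} → Subset n → List (Fin n)
toList []            = []
toList (inside ∷ p)  = Fin.zero ∷ map Fin.suc (toList p)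
toList (outside ∷ p) = map Fin.suc (toList p)

toList-length : ∀ {n} (p : Subset n) → length (toList p) ≡ ∣ p ∣
toList-length []            = refl
toList-length (inside ∷ p)  = cong suc (trans (length-map Fin.suc (toList p)) (toList-length p))
toList-length (outside ∷ p) = trans (length-map Fin.suc (toList p)) (toList-length p)

toList-complete : ∀ {n} (p : Subset n) {x} → x ∈ₛ p → x ∈ toList p
toList-complete (inside ∷ p)  here      = here refl
toList-complete (inside ∷ p)  (there m) = there (∈-map⁺ Fin.suc (toList-complete p m))
toList-complete (outside ∷ p) (there m) = ∈-map⁺ Fin.suc (toList-complete p m)

toList-sound : ∀ {n} (p : Subset n) {x} → x ∈ toList p → x ∈ₛ p
toList-sound (inside ∷ p) (here refl) = here
toList-sound (inside ∷ p) (there m) with _ , m′ , refl ← ∈-map⁻ Fin.suc m = there (toList-sound p m′)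
toList-sound (outside ∷ p) m        with _ , m′ , refl ← ∈-map⁻ Fin.suc m = there (toList-sound p m′)

toList-unique : ∀ {n} (p : Subset n) → Unique (toList p)
toList-unique []            = []
toList-unique (inside ∷ p)  =
  All.map⁺ (All.tabulate (λ _ ())) ∷ Unique.map⁺ Fin.suc-injective (toList-unique p)
toList-unique (outside ∷ p) = Unique.map⁺ Fin.suc-injective (toList-unique p)

subset-witnessed-≤ : ∀ {n} {B : Set} (R : Fin n → B → Set) →
  (∀ {x x′ e} → R x e → R x′ e → x ≡ x′) →
  (p : Subset n) {ys : List B} → (∀ {x} → x ∈ₛ p → Any (R x) ys) → ∣ p ∣ ≤ length ys
subset-witnessed-≤ R R-inj p {ys} witness =
  subst (_≤ length ys) (toList-length p)
    (witnessed-length-≤ R R-inj (toList-unique p)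
      (All.tabulate (λ m → witness (toList-sound p m))))

subsetOf : ∀ {n} {P : Fin n → Set} → (∀ x → Dec (P x)) → Subset n
subsetOf P? = tabulate (does ∘ P?)

∈-subsetOf⁺ : ∀ {n} {P : Fin n → Set} (P? : ∀ x → Dec (P x)) {x} → P x → x ∈ₛ subsetOf P?
∈-subsetOf⁺ P? {x} px =
  Vec.lookup⇒[]= x _ (trans (Vec.lookup∘tabulate _ x) (dec-true (P? x) px))

∈-subsetOf⁻ : ∀ {n} {P : Fin n → Set} (P? : ∀ x → Dec (P x)) {x} → x ∈ₛ subsetOf P? → P x
∈-subsetOf⁻ P? {x} m = accepted (P? x) (trans (sym (Vec.lookup∘tabulate _ x)) (Vec.[]=⇒lookup m))
  where
  accepted : ∀ {A : Set} (a? : Dec A) → does a? ≡ true → A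
  accepted (yes a) _ = a

trivial-Fin : ∀ {n} → n ≤ 1 → (u v : Fin n) → u ≡ v
trivial-Fin {suc zero}    _         Fin.zero Fin.zero = refl
trivial-Fin {suc (suc _)} (s≤s ()) _ _

another-element : ∀ {n} → ¬ n ≤ 1 → (v : Fin n) → ∃ λ w → w ≢ v
another-element {suc zero}    n≰1 _ = ⊥-elim (n≰1 (s≤s z≤n))
another-element {suc (suc _)} _   v = punchIn v Fin.zero , Fin.punchInᵢ≢i v Fin.zero

module DominatingVertex
  {n : ℕ} (Adj : Fin n → Fin n → Set)
  (adj? : ∀ u v → Dec (Adj u v))
  (adj-sym : ∀ {u v} → Adj u v → Adj v u)
  (adj-irrefl : ∀ {u v} → Adj u v → u ≢ v)
  (hub : Fin n) (hub-adj : ∀ {y} → y ≢ hub → Adj y hub)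
  where

  -- Edges are ordered pairs; an edge set lists each edge in one orientation.
  Edge : Set
  Edge = Fin n × Fin n

  neighbourhood : Fin n → Subset n
  neighbourhood v = subsetOf (adj? v)

  degree : Fin n → ℕ
  degree v = ∣ neighbourhood v ∣

  neighbourhood-spec : ∀ v → IsNeighbourhood Adj v (neighbourhood v)
  neighbourhood-spec v u = ∈-subsetOf⁻ (adj? v) , ∈-subsetOf⁺ (adj? v)

  neighbourhood-unique : ∀ v S → IsNeighbourhood Adj v S → S ≡ neighbourhood v
  neighbourhood-unique v S spec =
    ⊆-antisym (λ {u} m → ∈-subsetOf⁺ (adj? v) (proj₁ (spec u) m))
              (λ {u} m → proj₂ (spec u) (∈-subsetOf⁻ (adj? v) m))

  -- A vertex of minimum degree (the vertex set is non-empty: it has hub).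
  v₀ : Fin n
  v₀ = argmin degree hub (allFin n)

  v₀-minimal : ∀ w → degree v₀ ≤ degree w
  v₀-minimal w = All.lookup (f[argmin]≤f[xs] hub (allFin n)) (∈-allFin w)

  minDegree : IsMinDegree Adj (degree v₀)
  minDegree =
    (v₀ , neighbourhood v₀ , neighbourhood-spec v₀ , refl) ,
    λ v S spec → subst (λ T → degree v₀ ≤ ∣ T ∣) (sym (neighbourhood-unique v S spec)) (v₀-minimal v)

  Remaining : List Edge → Fin n → Fin n → Set
  Remaining = DeleteEdges Adj

  remaining-sym : ∀ F {u v} → Remaining F u v → Remaining F v u
  remaining-sym F (a , ∉F) = adj-sym a , ∉F ∘ ⊎-swap

  star : Fin n → List Edge
  star v = map (v ,_) (toList (neighbourhood v))

  star-adjacent : ∀ v → All (Adj v) (toList (neighbourhood v))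
  star-adjacent v = All.tabulate (∈-subsetOf⁻ (adj? v) ∘ toList-sound (neighbourhood v))

  star-distinct : ∀ v {zs : List (Fin n)} → Unique zs → All (_≢ v) zs →
                  AllPairs (λ e f → e ≢ f × e ≢ swap f) (map (v ,_) zs)
  star-distinct v []                 []              = []
  star-distinct v (z≢zs ∷ uniq) (z≢v ∷ zs≢v) =
    All.map⁺ (All.map (λ z≢w → (z≢w ∘ cong proj₂) , (z≢v ∘ cong proj₂)) z≢zs)
    ∷ star-distinct v uniq zs≢v

  star-isEdgeSet : ∀ v → IsEdgeSet Adj (star v)
  star-isEdgeSet v =
    All.map⁺ (star-adjacent v) ,
    star-distinct v (toList-unique (neighbourhood v))
                    (All.map (λ a → adj-irrefl a ∘ sym) (star-adjacent v))

  length-star : ∀ v → length (star v) ≡ degree v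
  length-star v = trans (length-map (v ,_) (toList (neighbourhood v))) (toList-length (neighbourhood v))

  star-disconnects : ∀ v → DisconnectedOrTrivial n (Remaining (star v))
  star-disconnects v with n ≤? 1
  ... | yes n≤1 = inj₁ n≤1
  ... | no  n≰1 with w , w≢v ← another-element n≰1 v = inj₂ (v , w , isolated)
    where
    isolated : ¬ Star (Remaining (star v)) v w
    isolated RT.ε             = w≢v refl
    isolated ((a , ∉F) ◅ _)   =
      ∉F (inj₁ (∈-map⁺ (v ,_) (toList-complete _ (∈-subsetOf⁺ (adj? v) a))))

  -- Lower bound.  An edge e blocks the route x–y–hub if it is one of
  -- xy, yx, y hub, hub y, i.e. one end is y and the other is x or hub.

  OnRoute : Fin n → Fin n → Set
  OnRoute x z = z ≡ x ⊎ z ≡ hub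

  Blocks : Fin n → Fin n → Edge → Set
  Blocks x y (a , b) = (a ≡ y × OnRoute x b) ⊎ (b ≡ y × OnRoute x a)

  blocks? : ∀ x y e → Dec (Blocks x y e)
  blocks? x y (a , b) = (a Fin.≟ y ×-dec onRoute? b) ⊎-dec (b Fin.≟ y ×-dec onRoute? a)
    where
    onRoute? : ∀ z → Dec (OnRoute x z)
    onRoute? z = (z Fin.≟ x) ⊎-dec (z Fin.≟ hub)

  AllBlocked : List Edge → Fin n → Set
  AllBlocked F x = ∀ y → Adj x y → Any (Blocks x y) F

  allBlocked? : ∀ F x → Dec (AllBlocked F x)
  allBlocked? F x = Fin.all? (λ y → adj? x y →-dec any? (blocks? x y) F)

  route-is-hub : ∀ {x y z} → z ≡ y → OnRoute x z → x ≢ y → y ≡ hub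
  route-is-hub refl (inj₁ refl)  x≢y = ⊥-elim (x≢y refl)
  route-is-hub refl (inj₂ z≡hub) _   = z≡hub

  blocks-injective : ∀ {x y y′ e} → x ≢ y → x ≢ y′ → Blocks x y e → Blocks x y′ e → y ≡ y′
  blocks-injective _ _ (inj₁ (a≡y , _)) (inj₁ (a≡y′ , _)) = trans (sym a≡y) a≡y′
  blocks-injective _ _ (inj₂ (b≡y , _)) (inj₂ (b≡y′ , _)) = trans (sym b≡y) b≡y′
  blocks-injective x≢y x≢y′ (inj₁ (a≡y , b-on)) (inj₂ (b≡y′ , a-on)) =
    trans (route-is-hub a≡y a-on x≢y) (sym (route-is-hub b≡y′ b-on x≢y′))
  blocks-injective x≢y x≢y′ (inj₂ (b≡y , a-on)) (inj₁ (a≡y′ , b-on)) =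
    trans (route-is-hub b≡y b-on x≢y) (sym (route-is-hub a≡y′ a-on x≢y′))

  blocked-degree-≤ : ∀ F x → AllBlocked F x → degree x ≤ length F
  blocked-degree-≤ F x blocked =
    subset-witnessed-≤ (λ y e → x ≢ y × Blocks x y e)
      (λ (x≢y , b) (x≢y′ , b′) → blocks-injective x≢y x≢y′ b b′)
      (neighbourhood x)
      (λ m → let a = ∈-subsetOf⁻ (adj? x) m in
             Any.map (adj-irrefl a ,_) (blocked _ a))

  first-edge-survives : ∀ F {x y} → Adj x y → ¬ Any (Blocks x y) F → Remaining F x y
  first-edge-survives F a unblocked =
    a , [ (λ m → unblocked (lose m (inj₂ (refl , inj₁ refl))))
        , (λ m → unblocked (lose m (inj₁ (refl , inj₁ refl)))) ]

  second-edge-survives : ∀ F {x y} → y ≢ hub → ¬ Any (Blocks x y) F → Remaining F y hub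
  second-edge-survives F y≢hub unblocked =
    hub-adj y≢hub , [ (λ m → unblocked (lose m (inj₁ (refl , inj₂ refl))))
                    , (λ m → unblocked (lose m (inj₂ (refl , inj₂ refl)))) ]

  unblocked-route : ∀ F {x y} → Adj x y → ¬ Any (Blocks x y) F → Star (Remaining F) x hub
  unblocked-route F {y = y} a unblocked with y Fin.≟ hub
  ... | yes refl  = first-edge-survives F a unblocked ◅ RT.ε
  ... | no  y≢hub = first-edge-survives F a unblocked
                  ◅ second-edge-survives F y≢hub unblocked ◅ RT.ε

  unblocked-reaches-hub : ∀ F x → ¬ AllBlocked F x → Star (Remaining F) x hub
  unblocked-reaches-hub F x ¬blocked
    with y , ¬[adj⇒blocked] ← Fin.¬∀⟶∃¬ n _ (λ y → adj? x y →-dec any? (blocks? x y) F) ¬blocked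
    with adj? x y
  ... | yes a  = unblocked-route F a (λ b → ¬[adj⇒blocked] (λ _ → b))
  ... | no  ¬a = ⊥-elim (¬[adj⇒blocked] (⊥-elim ∘ ¬a))

  some-vertex-blocked : ∀ F → DisconnectedOrTrivial n (Remaining F) → ∃ (AllBlocked F)
  some-vertex-blocked F (inj₁ n≤1) = hub , λ y a → ⊥-elim (adj-irrefl a (trivial-Fin n≤1 hub y))
  some-vertex-blocked F (inj₂ (u , v , u↮v)) with allBlocked? F u | allBlocked? F v
  ... | yes bu | _      = u , bu
  ... | no  _  | yes bv = v , bv
  ... | no ¬bu | no ¬bv = ⊥-elim (u↮v (unblocked-reaches-hub F u ¬bu
                            ◅◅ RT.reverse (remaining-sym F) (unblocked-reaches-hub F v ¬bv)))

  edgeConnectivity : IsEdgeConnectivity Adj (degree v₀)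
  edgeConnectivity =
    (star v₀ , star-isEdgeSet v₀ , length-star v₀ , star-disconnects v₀) ,
    λ F _ disconnected → let x , blocked = some-vertex-blocked F disconnected in
                         ℕ.≤-trans (v₀-minimal x) (blocked-degree-≤ F x blocked)

module PowerGraph (G : FiniteGroup) where
  open FiniteGroup G
  open IsGroup isGroup using (assoc; identityˡ; identityʳ)

  group : Group _ _
  group = record { isGroup = isGroup }

  open GroupProperties group using (∙-cancelˡ)

  pow-+ : ∀ u a b → pow u (a + b) ≡ pow u a ∙ pow u b
  pow-+ u zero    b = sym (identityˡ _)
  pow-+ u (suc a) b = trans (cong (u ∙_) (pow-+ u a b)) (sym (assoc u (pow u a) (pow u b)))

  -- Every element has a positive order at most n (pigeonhole on u⁰ … uⁿ).
  has-order : ∀ u → ∃ λ d → suc d ≤ n × pow u (suc d) ≡ ε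
  has-order u
    with i , j , i<j , uⁱ≡uʲ ← Fin.pigeonhole (ℕ.n<1+n n) (λ (i : Fin (suc n)) → pow u (toℕ i))
    with d , i+1+d≡j ← ℕ.m≤n⇒∃[o]m+o≡n i<j
    = d , order≤n , cancel
    where
    j≡i+[1+d] : toℕ i + suc d ≡ toℕ j
    j≡i+[1+d] = trans (ℕ.+-suc (toℕ i) d) i+1+d≡j
    order≤n : suc d ≤ n
    order≤n = ℕ.≤-trans (ℕ.m≤n+m (suc d) (toℕ i))
                (subst (_≤ n) (sym j≡i+[1+d]) (s≤s⁻¹ (Fin.toℕ<n j)))
    cancel : pow u (suc d) ≡ ε
    cancel = ∙-cancelˡ (pow u (toℕ i)) _ _ (begin
      pow u (toℕ i) ∙ pow u (suc d)  ≡⟨ pow-+ u (toℕ i) (suc d) ⟨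
      pow u (toℕ i + suc d)          ≡⟨ cong (pow u) j≡i+[1+d] ⟩
      pow u (toℕ j)                  ≡⟨ uⁱ≡uʲ ⟨
      pow u (toℕ i)                  ≡⟨ identityʳ _ ⟨
      pow u (toℕ i) ∙ ε              ∎)
      where open ≡-Reasoning

  reduce-exponent : ∀ {u d} → pow u (suc d) ≡ ε →
                    ∀ α → ∃ λ r → r ≤ d × pow u (suc α) ≡ pow u (suc r)
  reduce-exponent _ zero = zero , z≤n , refl
  reduce-exponent {u} uᵈ⁺¹≡ε (suc α)
    with r , r≤d , eq ← reduce-exponent uᵈ⁺¹≡ε α
    with ℕ.m≤n⇒m<n∨m≡n r≤d
  ... | inj₁ r<d  = suc r , r<d , cong (u ∙_) eq
  ... | inj₂ refl = zero , z≤n , cong (u ∙_) (trans eq uᵈ⁺¹≡ε)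

  bounded-exponent : ∀ u α → ∃ λ (i : Fin n) → pow u (suc α) ≡ pow u (suc (toℕ i))
  bounded-exponent u α
    with d , order≤n , uᵈ⁺¹≡ε ← has-order u
    with r , r≤d , eq ← reduce-exponent uᵈ⁺¹≡ε α
    = fromℕ< r<n , trans eq (cong (pow u ∘ suc) (sym (Fin.toℕ-fromℕ< r<n)))
    where
    r<n : r < n
    r<n = ℕ.≤-trans (s≤s r≤d) order≤n

  -- "v is a positive power of u" is decidable: only exponents ≤ n matter.
  isPositivePower? : ∀ u v → Dec (∃ λ α → v ≡ pow u (suc α))
  isPositivePower? u v =
    map′ (λ (i , eq) → toℕ i , eq)
         (λ (α , eq) → let i , eq′ = bounded-exponent u α in i , trans eq eq′)
         (Fin.any? (λ i → v Fin.≟ pow u (suc (toℕ i))))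

  powerAdj? : ∀ u v → Dec (PowerAdj G u v)
  powerAdj? u v = ¬? (u Fin.≟ v) ×-dec (isPositivePower? u v ⊎-dec isPositivePower? v u)

  powerAdj-sym : ∀ {u v} → PowerAdj G u v → PowerAdj G v u
  powerAdj-sym (u≢v , v∈⟨u⟩⊎u∈⟨v⟩) = u≢v ∘ sym , ⊎-swap v∈⟨u⟩⊎u∈⟨v⟩

  identity-dominates : ∀ {y} → y ≢ ε → PowerAdj G y ε
  identity-dominates {y} y≢ε with d , _ , yᵈ⁺¹≡ε ← has-order y = y≢ε , inj₁ (d , sym yᵈ⁺¹≡ε)

theorem3p2 : (G : FiniteGroup) →
    Σ ℕ (λ k → IsMinDegree (PowerAdj G) k × IsEdgeConnectivity (PowerAdj G) k)
theorem3p2 G = degree v₀ , minDegree , edgeConnectivity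
  where
  open PowerGraph G
  open DominatingVertex (PowerAdj G) powerAdj? powerAdj-sym proj₁
                        (FiniteGroup.ε G) identity-dominates
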